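{- Let $n$ be a positive integer relatively prime to $10$. Then $n$ is a strong Lucas probable prime for Method A if and only if $n$ is a strong Lucas probable prime for Method A*.
   Context: For integers $P > 0$ and $Q$ with $D = P^2 - 4Q \ne 0$, the Lucas sequences $U_j(P,Q)$, $V_j(P,Q)$ are defined by $U_0 = 0$, $U_1 = 1$, $V_0 = 2$, $V_1 = P$, and $U_j = PU_{j-1} - QU_{j-2}$, $V_j = PV_{j-1} - QV_{j-2}$ for $j \ge 2$. Method A: let $D$ be the first element of the sequence $5, -7, 9, -11, 13, -15, \ldots$ (i.e. $(-1)^{j}(2j+5)$ for $j = 0,1,2,\dots$) for which the Jacobi symbol $(D/n) = -1$, and set $P = 1$, $Q = (1-D)/4$. Method A*: choose $D, P, Q$ as in Method A, but if $Q = -1$ (i.e. $D = 5$), replace $P$ and $Q$ both by $5$ (so $D$ is unchanged). Write $n + 1 = d \cdot 2^s$ with $d$ odd. We say $n$ is a strong Lucas probable prime for a method if the method produces parameters $P, Q$ (so $(D/n) = -1$) and either $U_d(P,Q) \equiv 0 \pmod n$ or $V_{d\cdot 2^r}(P,Q) \equiv 0 \pmod n$ for some $r$ with $0 \le r < s$. -}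

module Defs where

open import Data.Nat as ℕ using (ℕ; zero; suc; _<_; _≤?_)
open import Data.Nat.Divisibility as ℕD using ()
open import Data.Nat.DivMod using (_/_)
open import Data.Integer as ℤ using (ℤ; +_; -_; _-_; _*_)
open import Data.Integer.DivMod renaming (_/_ to _div_) using ()
open import Data.Integer.Divisibility using (_∣_)
import Data.Integer.Divisibility.Signed as ℤS
open import Data.Fin using (Fin; toℕ)
open import Data.Fin.Properties using (any?)
open import Data.Product using (Σ; ∃; _×_; _,_)
open import Data.Sum using (_⊎_)
open import Relation.Nullary using (yes; no; ¬_)
open import Relation.Binary.PropositionalEquality using (_≡_)

UV : ℤ → ℤ → ℕ → ℤ × ℤ × ℤ × ℤ   -- (U_j, U_{j+1}, V_j, V_{j+1})
UV P Q zero    = + 0 , + 1 , + 2 , P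
UV P Q (suc j) with UV P Q j
... | u0 , u1 , v0 , v1 = u1 , P * u1 - Q * u0 , v1 , P * v1 - Q * v0

U : ℤ → ℤ → ℕ → ℤ
U P Q j with UV P Q j
... | u , _ , _ , _ = u

V : ℤ → ℤ → ℕ → ℤ
V P Q j with UV P Q j
... | _ , _ , v , _ = v

legendre : ℤ → ℕ → ℤ
legendre a p with (+ p) ℤS.∣? a
... | yes _ = + 0
... | no _ with any? {n = p} (λ (x : Fin p) → (+ p) ℤS.∣? ((+ toℕ x) * (+ toℕ x) - a))
...   | yes _ = + 1
...   | no _  = - (+ 1)

-- Computed by trial division: the candidate divisor is 2+k; the first
-- candidate dividing the remaining cofactor m is its least prime factor.
jacobiGo : ℤ → ℕ → ℕ → ℕ → ℤ
jacobiGo a zero    k m = + 1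
jacobiGo a (suc f) k m with m ≤? 1
... | yes _ = + 1
... | no _ with (suc (suc k)) ℕD.∣? m
...   | yes _ = legendre a (suc (suc k)) * jacobiGo a f k (m / suc (suc k))
...   | no _  = jacobiGo a f (suc k) m

jacobi : ℤ → ℕ → ℤ
jacobi a n = jacobiGo a (2 ℕ.* n ℕ.+ 2) 0 n

Dseq : ℕ → ℤ
Dseq j with j ℕ.% 2
... | zero = + (2 ℕ.* j ℕ.+ 5)
... | suc _ = - (+ (2 ℕ.* j ℕ.+ 5))

SelectsA : ℕ → ℕ → Set
SelectsA n j = jacobi (Dseq j) n ≡ - (+ 1) × (∀ i → i < j → ¬ (jacobi (Dseq i) n ≡ - (+ 1)))

paramsA : ℤ → ℤ × ℤ
paramsA D = + 1 , (+ 1 - D) div (+ 4)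

paramsA* : ℤ → ℤ × ℤ
paramsA* D with paramsA D
... | P , Q with Q ℤ.≟ - (+ 1)
...   | yes _ = + 5 , + 5
...   | no _  = P , Q

StrongCond : ℕ → ℤ → ℤ → Set
StrongCond n P Q =
  ∃ λ d → ∃ λ s → (n ℕ.+ 1 ≡ d ℕ.* (2 ℕ.^ s)) × (d ℕ.% 2 ≡ 1) ×
    ((+ n) ∣ U P Q d ⊎ (∃ λ r → r < s × (+ n) ∣ V P Q (d ℕ.* (2 ℕ.^ r))))

StrongLPRP : (ℤ → ℤ × ℤ) → ℕ → Set
StrongLPRP method n = ∃ λ j → SelectsA n j × StrongCondP (method (Dseq j))
  where
  StrongCondP : ℤ × ℤ → Set
  StrongCondP (P , Q) = StrongCond n P Q

SLPRP-A : ℕ → Set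
SLPRP-A = StrongLPRP paramsA

SLPRP-A* : ℕ → Set
SLPRP-A* = StrongLPRP paramsA*

{-# OPTIONS --safe #-}
module Submission where

-- For D = 5, Method A uses (P, Q) = (1, -1) and Method A* uses (5, 5), whose characteristic
-- roots are √5·α and -√5·β for the roots α, β of x² - x - 1.  Hence for odd d
--   U_d(5,5) = 5^((d-1)/2) V_d(1,-1),  V_d(5,5) = 5^((d+1)/2) U_d(1,-1),  V_2k(5,5) = 5^k V_2k(1,-1).
-- Since gcd(n, 5) = 1 the powers of 5 do not affect divisibility by n, so the two strong tests
-- agree once the condition on U_d is exchanged with the condition on V_d (the case r = 0, which
-- exists because n is odd and so s ≥ 1).  Every later D of the sequence has |D| ≥ 7, so Q ≠ -1
-- and the two methods coincide.

open import Defs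
open import Data.Empty using (⊥-elim)
open import Data.Integer as ℤ using (ℤ; +_; -_; _-_; _*_; _+_; _^_)
open import Data.Integer.Coprimality using (coprime-divisor)
open import Data.Integer.Divisibility using (_∣_)
open import Data.Integer.DivMod using (a≡a%n+[a/n]*n; n%d<d) renaming (_/_ to _div_; _%_ to _mod_)
open import Data.Integer.Properties using (*-identityˡ; *-assoc; abs-*; ∣-i∣≡∣i∣)
open import Data.Integer.Tactic.RingSolver using (solve-∀)
open import Data.Nat as ℕ using (ℕ; zero; suc; _<_; _>_; z<s)
open import Data.Nat.Coprimality using (Coprime)
import Data.Nat.Divisibility as ℕ
open import Data.Nat.DivMod using (m≡m%n+[m/n]*n)
import Data.Nat.Properties as ℕ
open import Data.Product using (∃; _×_; _,_; proj₁; proj₂; map₂)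
open import Data.Sum using (_⊎_; inj₁; inj₂)
open import Function.Bundles using (_⇔_; mk⇔; Equivalence)
import Function.Properties.Equivalence as ⇔
open import Relation.Binary.PropositionalEquality
open import Relation.Nullary using (¬_; yes; no)

open Equivalence using (to; from)
open ≡-Reasoning

fib lucas : ℕ → ℤ
fib   = U (+ 1) (- (+ 1))
lucas = V (+ 1) (- (+ 1))

V≡2U[1+j]-PU[j] : ∀ P Q j → V P Q j ≡ + 2 * U P Q (suc j) - P * U P Q j
V≡2U[1+j]-PU[j] P Q zero = base₀ P
  where
  base₀ : ∀ P → + 2 ≡ + 2 * + 1 - P * + 0
  base₀ = solve-∀
V≡2U[1+j]-PU[j] P Q (suc zero) = base₁ P Q
  where
  base₁ : ∀ P Q → P ≡ + 2 * (P * + 1 - Q * + 0) - P * + 1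
  base₁ = solve-∀
V≡2U[1+j]-PU[j] P Q (suc (suc j)) = begin
  P * V P Q (suc j) - Q * V P Q j
    ≡⟨ cong₂ (λ v₁ v₀ → P * v₁ - Q * v₀) (V≡2U[1+j]-PU[j] P Q (suc j)) (V≡2U[1+j]-PU[j] P Q j) ⟩
  P * (+ 2 * (P * u₁ - Q * u₀) - P * u₁) - Q * (+ 2 * u₁ - P * u₀)
    ≡⟨ identity P Q u₀ u₁ ⟩
  + 2 * (P * (P * u₁ - Q * u₀) - Q * u₁) - P * (P * u₁ - Q * u₀) ∎
  where
  u₀ = U P Q j
  u₁ = U P Q (suc j)
  identity : ∀ P Q u₀ u₁ →
    P * (+ 2 * (P * u₁ - Q * u₀) - P * u₁) - Q * (+ 2 * u₁ - P * u₀) ≡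
    + 2 * (P * (P * u₁ - Q * u₀) - Q * u₁) - P * (P * u₁ - Q * u₀)
  identity = solve-∀

lucas-suc : ∀ j → lucas (suc j) ≡ fib (suc j) + + 2 * fib j
lucas-suc j = trans (V≡2U[1+j]-PU[j] (+ 1) (- (+ 1)) (suc j)) (identity (fib j) (fib (suc j)))
  where
  identity : ∀ a b → + 2 * (+ 1 * b - - (+ 1) * a) - + 1 * b ≡ b + + 2 * a
  identity = solve-∀

U₅₅-via-fib : ∀ m → U (+ 5) (+ 5) (m ℕ.* 2) ≡ (+ 5) ^ m * fib (m ℕ.* 2)
                  × U (+ 5) (+ 5) (suc (m ℕ.* 2)) ≡ (+ 5) ^ m * (fib (suc (m ℕ.* 2)) + + 2 * fib (m ℕ.* 2))
U₅₅-via-fib zero = refl , refl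
U₅₅-via-fib (suc m) = even , odd
  where
  -- The last lines of both chains are fib (2 + k), fib (3 + k) unfolded: the recurrence is definitional.
  k = m ℕ.* 2
  x = (+ 5) ^ m
  a = fib k
  b = fib (suc k)
  even : U (+ 5) (+ 5) (suc (suc k)) ≡ + 5 * x * fib (suc (suc k))
  even = begin
    + 5 * U (+ 5) (+ 5) (suc k) - + 5 * U (+ 5) (+ 5) k
      ≡⟨ cong₂ (λ u₁ u₀ → + 5 * u₁ - + 5 * u₀) (proj₂ (U₅₅-via-fib m)) (proj₁ (U₅₅-via-fib m)) ⟩
    + 5 * (x * (b + + 2 * a)) - + 5 * (x * a)
      ≡⟨ identity x a b ⟩
    + 5 * x * (+ 1 * b - - (+ 1) * a) ∎
    where
    identity : ∀ x a b → + 5 * (x * (b + + 2 * a)) - + 5 * (x * a) ≡ + 5 * x * (+ 1 * b - - (+ 1) * a)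
    identity = solve-∀
  odd : U (+ 5) (+ 5) (suc (suc (suc k))) ≡ + 5 * x * (fib (suc (suc (suc k))) + + 2 * fib (suc (suc k)))
  odd = begin
    + 5 * U (+ 5) (+ 5) (suc (suc k)) - + 5 * U (+ 5) (+ 5) (suc k)
      ≡⟨ cong₂ (λ u₁ u₀ → + 5 * u₁ - + 5 * u₀) even (proj₂ (U₅₅-via-fib m)) ⟩
    + 5 * (+ 5 * x * (+ 1 * b - - (+ 1) * a)) - + 5 * (x * (b + + 2 * a))
      ≡⟨ identity x a b ⟩
    + 5 * x * ((+ 1 * (+ 1 * b - - (+ 1) * a) - - (+ 1) * b) + + 2 * (+ 1 * b - - (+ 1) * a)) ∎
    where
    identity : ∀ x a b →
      + 5 * (+ 5 * x * (+ 1 * b - - (+ 1) * a)) - + 5 * (x * (b + + 2 * a)) ≡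
      + 5 * x * ((+ 1 * (+ 1 * b - - (+ 1) * a) - - (+ 1) * b) + + 2 * (+ 1 * b - - (+ 1) * a))
    identity = solve-∀

module _ (m : ℕ) where
  private
    k = m ℕ.* 2
    x = (+ 5) ^ m
    a = fib k
    b = fib (suc k)

  U₅₅-odd : U (+ 5) (+ 5) (suc k) ≡ x * lucas (suc k)
  U₅₅-odd = trans (proj₂ (U₅₅-via-fib m)) (cong (x *_) (sym (lucas-suc k)))

  V₅₅-even : V (+ 5) (+ 5) k ≡ x * lucas k
  V₅₅-even = begin
    V (+ 5) (+ 5) k
      ≡⟨ V≡2U[1+j]-PU[j] (+ 5) (+ 5) k ⟩
    + 2 * U (+ 5) (+ 5) (suc k) - + 5 * U (+ 5) (+ 5) k
      ≡⟨ cong₂ (λ u₁ u₀ → + 2 * u₁ - + 5 * u₀) (proj₂ (U₅₅-via-fib m)) (proj₁ (U₅₅-via-fib m)) ⟩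
    + 2 * (x * (b + + 2 * a)) - + 5 * (x * a)
      ≡⟨ identity x a b ⟩
    x * (+ 2 * b - + 1 * a)
      ≡⟨ cong (x *_) (V≡2U[1+j]-PU[j] (+ 1) (- (+ 1)) k) ⟨
    x * lucas k ∎
    where
    identity : ∀ x a b → + 2 * (x * (b + + 2 * a)) - + 5 * (x * a) ≡ x * (+ 2 * b - + 1 * a)
    identity = solve-∀

  V₅₅-odd : V (+ 5) (+ 5) (suc k) ≡ + 5 * x * fib (suc k)
  V₅₅-odd = begin
    V (+ 5) (+ 5) (suc k)
      ≡⟨ V≡2U[1+j]-PU[j] (+ 5) (+ 5) (suc k) ⟩
    + 2 * U (+ 5) (+ 5) (suc (suc k)) - + 5 * U (+ 5) (+ 5) (suc k)
      ≡⟨ cong₂ (λ u₁ u₀ → + 2 * u₁ - + 5 * u₀) (proj₁ (U₅₅-via-fib (suc m))) (proj₂ (U₅₅-via-fib m)) ⟩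
    + 2 * (+ 5 * x * (+ 1 * b - - (+ 1) * a)) - + 5 * (x * (b + + 2 * a))
      ≡⟨ identity x a b ⟩
    + 5 * x * b ∎
    where
    identity : ∀ x a b → + 2 * (+ 5 * x * (+ 1 * b - - (+ 1) * a)) - + 5 * (x * (b + + 2 * a)) ≡ + 5 * x * b
    identity = solve-∀

coprime⇒∣^*⇔∣ : ∀ {n c} → Coprime n c → ∀ k i → (+ n) ∣ (+ c) ^ k * i ⇔ (+ n) ∣ i
coprime⇒∣^*⇔∣ {n} {c} n⊥c k i = mk⇔ (cancel k) multiply
  where
  multiply : (+ n) ∣ i → (+ n) ∣ (+ c) ^ k * i
  multiply n∣i = subst (n ℕ.∣_) (sym (abs-* ((+ c) ^ k) i)) (ℕ.∣n⇒∣m*n ℤ.∣ (+ c) ^ k ∣ n∣i)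
  cancel : ∀ k → (+ n) ∣ (+ c) ^ k * i → (+ n) ∣ i
  cancel zero    n∣i = subst ((+ n) ∣_) (*-identityˡ i) n∣i
  cancel (suc k) n∣i = cancel k (coprime-divisor (+ n) (+ c) _ n⊥c (subst ((+ n) ∣_) (*-assoc (+ c) _ i) n∣i))

StrongTest : ℕ → ℤ → ℤ → ℕ → ℕ → Set
StrongTest n P Q d s = (+ n) ∣ U P Q d ⊎ ∃ λ r → r < s × (+ n) ∣ V P Q (d ℕ.* (2 ℕ.^ r))

strongTest-swap : ∀ {n P Q P′ Q′} d s →
  ((+ n) ∣ U P Q d → (+ n) ∣ V P′ Q′ d) →
  ((+ n) ∣ V P Q d → (+ n) ∣ U P′ Q′ d) →
  (∀ r → (+ n) ∣ V P Q (d ℕ.* (2 ℕ.^ suc r)) → (+ n) ∣ V P′ Q′ (d ℕ.* (2 ℕ.^ suc r))) →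
  StrongTest n P Q d (suc s) → StrongTest n P′ Q′ d (suc s)
strongTest-swap {n} {P} {Q} {P′} {Q′} d s U⇒V V⇒U V⇒V = λ where
  (inj₁ n∣U)                 → inj₂ (0 , z<s , subst (λ e → (+ n) ∣ V P′ Q′ e) (sym (ℕ.*-identityʳ d)) (U⇒V n∣U))
  (inj₂ (zero  , _   , n∣V)) → inj₁ (V⇒U (subst (λ e → (+ n) ∣ V P Q e) (ℕ.*-identityʳ d) n∣V))
  (inj₂ (suc r , r<s , n∣V)) → inj₂ (suc r , r<s , V⇒V r n∣V)

strongTest-[1,-1]⇔[5,5] : ∀ {n} → Coprime n 5 → ∀ m s →
  StrongTest n (+ 1) (- (+ 1)) (suc (m ℕ.* 2)) (suc s) ⇔ StrongTest n (+ 5) (+ 5) (suc (m ℕ.* 2)) (suc s)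
strongTest-[1,-1]⇔[5,5] {n} n⊥5 m s = mk⇔
  (strongTest-swap d s (to U₁⇔V₅) (to V₁⇔U₅) (λ r → to (V₁⇔V₅ r)))
  (strongTest-swap d s (from V₁⇔U₅) (from U₁⇔V₅) (λ r → from (V₁⇔V₅ r)))
  where
  d = suc (m ℕ.* 2)
  scaled : ∀ {i j} k → j ≡ (+ 5) ^ k * i → (+ n) ∣ i ⇔ (+ n) ∣ j
  scaled k refl = ⇔.sym (coprime⇒∣^*⇔∣ n⊥5 k _)
  U₁⇔V₅ : (+ n) ∣ fib d ⇔ (+ n) ∣ V (+ 5) (+ 5) d
  U₁⇔V₅ = scaled (suc m) (V₅₅-odd m)
  V₁⇔U₅ : (+ n) ∣ lucas d ⇔ (+ n) ∣ U (+ 5) (+ 5) d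
  V₁⇔U₅ = scaled m (U₅₅-odd m)
  V₁⇔V₅ : ∀ r → (+ n) ∣ lucas (d ℕ.* (2 ℕ.^ suc r)) ⇔ (+ n) ∣ V (+ 5) (+ 5) (d ℕ.* (2 ℕ.^ suc r))
  V₁⇔V₅ r = subst (λ e → (+ n) ∣ lucas e ⇔ (+ n) ∣ V (+ 5) (+ 5) e) (sym d2ʳ⁺¹≡d2ʳ*2)
                  (scaled (d ℕ.* (2 ℕ.^ r)) (V₅₅-even (d ℕ.* (2 ℕ.^ r))))
    where
    d2ʳ⁺¹≡d2ʳ*2 : d ℕ.* (2 ℕ.^ suc r) ≡ d ℕ.* (2 ℕ.^ r) ℕ.* 2
    d2ʳ⁺¹≡d2ʳ*2 = trans (cong (d ℕ.*_) (ℕ.*-comm 2 (2 ℕ.^ r))) (sym (ℕ.*-assoc d (2 ℕ.^ r) 2))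

m%2≡1⇒m≡1+[m/2]*2 : ∀ m → m ℕ.% 2 ≡ 1 → m ≡ suc (m ℕ./ 2 ℕ.* 2)
m%2≡1⇒m≡1+[m/2]*2 m m%2≡1 = trans (m≡m%n+[m/n]*n m 2) (cong (ℕ._+ m ℕ./ 2 ℕ.* 2) m%2≡1)

strongCond-map : ∀ {n P Q P′ Q′} → ¬ 2 ℕ.∣ n →
  (∀ m s → StrongTest n P Q (suc (m ℕ.* 2)) (suc s) → StrongTest n P′ Q′ (suc (m ℕ.* 2)) (suc s)) →
  StrongCond n P Q → StrongCond n P′ Q′
strongCond-map {n} 2∤n _ (d , zero , n+1≡d*1 , d-odd , _) = ⊥-elim (2∤n (ℕ.divides (d ℕ./ 2) n≡[d/2]*2))
  where
  n≡[d/2]*2 : n ≡ d ℕ./ 2 ℕ.* 2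
  n≡[d/2]*2 = ℕ.suc-injective (begin
    suc n              ≡⟨ ℕ.+-comm 1 n ⟩
    n ℕ.+ 1            ≡⟨ n+1≡d*1 ⟩
    d ℕ.* 1            ≡⟨ ℕ.*-identityʳ d ⟩
    d                  ≡⟨ m%2≡1⇒m≡1+[m/2]*2 d d-odd ⟩
    suc (d ℕ./ 2 ℕ.* 2) ∎)
strongCond-map {n} {P} {Q} {P′} {Q′} _ test (d , suc s , n+1≡d2ˢ , d-odd , holds) =
  d , suc s , n+1≡d2ˢ , d-odd ,
  subst (λ e → StrongTest n P′ Q′ e (suc s)) (sym d≡) (test (d ℕ./ 2) s (subst (λ e → StrongTest n P Q e (suc s)) d≡ holds))
  where
  d≡ = m%2≡1⇒m≡1+[m/2]*2 d d-odd

paramsA*≡paramsA : ∀ D → proj₂ (paramsA D) ≢ - (+ 1) → paramsA* D ≡ paramsA D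
paramsA*≡paramsA D Q≢-1 with (+ 1 - D) div (+ 4) ℤ.≟ - (+ 1)
... | yes Q≡-1 = ⊥-elim (Q≢-1 Q≡-1)
... | no  _    = refl

paramsA-Q≡-1⇒∣D∣≤5 : ∀ D → proj₂ (paramsA D) ≡ - (+ 1) → ℤ.∣ D ∣ ℕ.≤ 5
paramsA-Q≡-1⇒∣D∣≤5 D Q≡-1 = subst (λ e → ℤ.∣ e ∣ ℕ.≤ 5) (sym D≡5-r) (bound r (n%d<d (+ 1 - D) (+ 4)))
  where
  r = (+ 1 - D) mod (+ 4)
  involution : ∀ D → D ≡ + 1 - (+ 1 - D)
  involution = solve-∀
  D≡5-r : D ≡ + 1 - (+ r + - (+ 1) * + 4)
  D≡5-r = trans (involution D) (cong (λ e → + 1 - e)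
    (trans (a≡a%n+[a/n]*n (+ 1 - D) (+ 4)) (cong (λ q → + r + q * + 4) Q≡-1)))
  bound : ∀ r → r < 4 → ℤ.∣ + 1 - (+ r + - (+ 1) * + 4) ∣ ℕ.≤ 5
  bound 0 _ = ℕ.m∸n≤m 5 0
  bound 1 _ = ℕ.m∸n≤m 5 1
  bound 2 _ = ℕ.m∸n≤m 5 2
  bound 3 _ = ℕ.m∸n≤m 5 3
  bound (suc (suc (suc (suc _)))) (ℕ.s≤s (ℕ.s≤s (ℕ.s≤s (ℕ.s≤s ()))))

∣Dseq∣ : ∀ j → ℤ.∣ Dseq j ∣ ≡ 2 ℕ.* j ℕ.+ 5
∣Dseq∣ j with j ℕ.% 2
... | zero  = refl
... | suc _ = ∣-i∣≡∣i∣ (+ (2 ℕ.* j ℕ.+ 5))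

paramsA*-Dseq-suc : ∀ j → paramsA* (Dseq (suc j)) ≡ paramsA (Dseq (suc j))
paramsA*-Dseq-suc j = paramsA*≡paramsA D (λ Q≡-1 → ℕ.<⇒≱ 5<∣D∣ (paramsA-Q≡-1⇒∣D∣≤5 D Q≡-1))
  where
  D = Dseq (suc j)
  5<∣D∣ : 5 < ℤ.∣ D ∣
  5<∣D∣ = subst (5 <_) (sym (∣Dseq∣ (suc j))) (ℕ.s≤s (ℕ.m≤n+m 5 _))

StrongCondAt : ℕ → ℤ × ℤ → Set
StrongCondAt n (P , Q) = StrongCond n P Q

strongCond-A⇔A* : ∀ {n} → Coprime n 10 → ∀ j →
  StrongCondAt n (paramsA (Dseq j)) ⇔ StrongCondAt n (paramsA* (Dseq j))
strongCond-A⇔A* {n} n⊥10 zero = mk⇔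
  (strongCond-map 2∤n (λ m s → to   (strongTest-[1,-1]⇔[5,5] n⊥5 m s)))
  (strongCond-map 2∤n (λ m s → from (strongTest-[1,-1]⇔[5,5] n⊥5 m s)))
  where
  2∤n : ¬ 2 ℕ.∣ n
  2∤n 2∣n with n⊥10 (2∣n , ℕ.divides 5 refl)
  ... | ()
  n⊥5 : Coprime n 5
  n⊥5 (d∣n , d∣5) = n⊥10 (d∣n , ℕ.∣-trans d∣5 (ℕ.divides 2 refl))
strongCond-A⇔A* {n} _ (suc j) =
  subst (λ p → StrongCondAt n (paramsA (Dseq (suc j))) ⇔ StrongCondAt n p) (sym (paramsA*-Dseq-suc j)) ⇔.refl

theorem4 : (n : ℕ) → n > 0 → Coprime n 10 →
    (SLPRP-A n → SLPRP-A* n) × (SLPRP-A* n → SLPRP-A n)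
theorem4 n _ n⊥10 =
  map₂ (λ {j} → map₂ (to (A⇔A* j))) , map₂ (λ {j} → map₂ (from (A⇔A* j)))
  where
  A⇔A* = strongCond-A⇔A* n⊥10
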